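{- Let $G$ be a maximal $3$-$\gamma_{c}$-vertex critical graph, $I$ a maximum independent set of $G$ and $W$ the vertex set of a maximum complete subgraph of $G$. For $w \in W$, let $D_{w}$ be a minimum connected dominating set of $G - w$. Then for every $w \in W$, $|D_{w} \cap W| = 0$ and $|D_{w} \cap I| \leq 1$.
   Context: All graphs are finite, simple and connected. A connected dominating set of $G$ is a set $D \subseteq V(G)$ such that every vertex of $G$ is in $D$ or adjacent to a vertex of $D$, and $G[D]$ is connected; $\gamma_{c}(G)$ is the minimum size of such a set. $G$ is $k$-$\gamma_{c}$-edge critical if $\gamma_{c}(G)=k$ and $\gamma_{c}(G+uv)<k$ for every pair of non-adjacent vertices $u,v$. A $2$-connected graph $G$ is $k$-$\gamma_{c}$-vertex critical if $\gamma_{c}(G)=k$ and $\gamma_{c}(G-v)<k$ for every $v \in V(G)$. $G$ is maximal $k$-$\gamma_{c}$-vertex critical if it is both $k$-$\gamma_{c}$-edge critical and $k$-$\gamma_{c}$-vertex critical. -}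

module Defs where

open import Data.Nat using (ℕ; _≤_; _<_)
open import Data.Fin using (Fin)
open import Data.Fin.Subset using (Subset; _∈_; _∉_; _⊆_; ⊤; _-_; ∣_∣)
open import Data.Product using (Σ; _×_; ∃; ∃-syntax)
open import Data.Sum using (_⊎_)
open import Relation.Binary.PropositionalEquality using (_≡_; _≢_)
open import Relation.Nullary using (¬_)

record Graph (n : ℕ) : Set₁ where
  field
    Adj   : Fin n → Fin n → Set
    sym   : ∀ {x y} → Adj x y → Adj y x
    irrefl : ∀ {x} → ¬ Adj x x
open Graph public

Rel : ℕ → Set₁
Rel n = Fin n → Fin n → Set

addEdge : ∀ {n} → Rel n → Fin n → Fin n → Rel n
addEdge E u v x y = E x y ⊎ ((x ≡ u × y ≡ v) ⊎ (x ≡ v × y ≡ u))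

-- Walks inside a vertex set S (i.e. in the induced subgraph on S).
data Reach {n} (E : Rel n) (S : Subset n) : Fin n → Fin n → Set where
  here : ∀ {x} → Reach E S x x
  step : ∀ {x y z} → E x y → y ∈ S → Reach E S y z → Reach E S x z

ConnectedOn : ∀ {n} → Rel n → Subset n → Set
ConnectedOn E S = ∀ x y → x ∈ S → y ∈ S → Reach E S x y

DominatesOn : ∀ {n} → Rel n → Subset n → Subset n → Set
DominatesOn E S D = ∀ x → x ∈ S → x ∈ D ⊎ (∃[ y ] (y ∈ D × E x y))

IsCDS : ∀ {n} → Rel n → Subset n → Subset n → Set
IsCDS E S D = D ⊆ S × DominatesOn E S D × ConnectedOn E D

GammaC : ∀ {n} → Rel n → Subset n → ℕ → Set
GammaC E S k = (∃[ D ] (IsCDS E S D × ∣ D ∣ ≡ k)) × (∀ D → IsCDS E S D → k ≤ ∣ D ∣)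

GammaCLess : ∀ {n} → Rel n → Subset n → ℕ → Set
GammaCLess E S k = ∃[ D ] (IsCDS E S D × ∣ D ∣ < k)

IsMinCDS : ∀ {n} → Rel n → Subset n → Subset n → Set
IsMinCDS E S D = IsCDS E S D × (∀ D′ → IsCDS E S D′ → ∣ D ∣ ≤ ∣ D′ ∣)

Connected : ∀ {n} → Graph n → Set
Connected G = ConnectedOn (Adj G) ⊤

TwoConnected : ∀ {n} → Graph n → Set
TwoConnected {n} G = 3 ≤ n × Connected G × (∀ v → ConnectedOn (Adj G) (⊤ - v))

EdgeCritical : ∀ {n} → ℕ → Graph n → Set
EdgeCritical k G =
  GammaC (Adj G) ⊤ k ×
  (∀ u v → u ≢ v → ¬ Adj G u v → GammaCLess (addEdge (Adj G) u v) ⊤ k)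

VertexCritical : ∀ {n} → ℕ → Graph n → Set
VertexCritical k G =
  TwoConnected G × GammaC (Adj G) ⊤ k × (∀ v → GammaCLess (Adj G) (⊤ - v) k)

MaximalVertexCritical : ∀ {n} → ℕ → Graph n → Set
MaximalVertexCritical k G = EdgeCritical k G × VertexCritical k G

Independent : ∀ {n} → Graph n → Subset n → Set
Independent G I = ∀ x y → x ∈ I → y ∈ I → ¬ Adj G x y

MaximumIndependent : ∀ {n} → Graph n → Subset n → Set
MaximumIndependent G I = Independent G I × (∀ J → Independent G J → ∣ J ∣ ≤ ∣ I ∣)

Clique : ∀ {n} → Graph n → Subset n → Set
Clique G W = ∀ x y → x ∈ W → y ∈ W → x ≢ y → Adj G x y

MaximumClique : ∀ {n} → Graph n → Subset n → Set
MaximumClique G W = Clique G W × (∀ J → Clique G J → ∣ J ∣ ≤ ∣ W ∣)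

module Submission where

--  * Vertex criticality gives γc(G - w) < 3, so the minimum D has |D| ≤ 2.
--  * If some vertex of D were adjacent to w, D would also dominate w and hence
--    be a connected dominating set of G itself, of size < 3 = γc(G).  So no
--    vertex of D is adjacent to w.
--  * Every other vertex of the clique W is adjacent to w, and D avoids w, so
--    D ∩ W = ∅.
--  * Two distinct vertices of D ∩ I are non-adjacent; a walk between them in
--    G[D] therefore passes through a third vertex of D, contradicting |D| ≤ 2.

open import Defs
open import Data.Nat using (_+_; _≤_; _<_; z≤n; s≤s)
open import Data.Nat.Properties using (≤-trans; ≤-reflexive; ≤-pred; <⇒≱; module ≤-Reasoning)
open import Data.Fin using (_≟_)
open import Data.Fin.Properties using (suc-injective; 0≢1+n)
open import Data.Fin.Subset using (Subset; _∈_; _∉_; _⊆_; _∩_; _─_; ⊤; _-_; ⁅_⁆; ∣_∣; inside; outside; Empty)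
open import Data.Fin.Subset.Properties
  using (∈⊤; ⊆⊤; x∈p∩q⁻; Empty-unique; ∣⊥∣≡0; x∈p∧x≢y⇒x∈p-y; x∈p⇒∣p-x∣<∣p∣; x∉⁅y⁆⇒x≢y)
open import Data.Vec using ([]; _∷_; _[_]=_)
open _[_]=_
open import Data.Product using (_×_; _,_)
open import Data.Sum using (inj₂)
open import Data.Empty using (⊥-elim)
open import Relation.Binary.PropositionalEquality using (_≡_; _≢_; refl; trans; cong) renaming (sym to ≡-sym)
open import Relation.Nullary using (¬_; yes; no)


empty⇒∣p∣≡0 : ∀ {n} {p : Subset n} → Empty p → ∣ p ∣ ≡ 0
empty⇒∣p∣≡0 {n} e = trans (cong ∣_∣ (Empty-unique e)) (∣⊥∣≡0 n)

atMostOneMember⇒∣p∣≤1 : ∀ {n} (p : Subset n) →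
  (∀ {a b} → a ∈ p → b ∈ p → a ≡ b) → ∣ p ∣ ≤ 1
atMostOneMember⇒∣p∣≤1 []            _    = z≤n
atMostOneMember⇒∣p∣≤1 (outside ∷ p) same =
  atMostOneMember⇒∣p∣≤1 p (λ a∈p b∈p → suc-injective (same (there a∈p) (there b∈p)))
atMostOneMember⇒∣p∣≤1 (inside ∷ p)  same =
  s≤s (≤-reflexive (empty⇒∣p∣≡0 λ { (a , a∈p) → 0≢1+n (same here (there a∈p)) }))

-- Three pairwise distinct members force cardinality at least 3:
-- removing a and then b strictly decreases the size each time, and c survives.
threeMembers⇒3≤∣p∣ : ∀ {n} {p : Subset n} {a b c} →
  a ∈ p → b ∈ p → c ∈ p → b ≢ a → c ≢ a → c ≢ b → 3 ≤ ∣ p ∣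
threeMembers⇒3≤∣p∣ {p = p} {a} {b} {c} a∈p b∈p c∈p b≢a c≢a c≢b = begin
  3                 ≤⟨ s≤s (s≤s (≤-trans (s≤s z≤n) (x∈p⇒∣p-x∣<∣p∣ c∈p-a-b))) ⟩
  2 + ∣ p - a - b ∣ ≤⟨ s≤s (x∈p⇒∣p-x∣<∣p∣ b∈p-a) ⟩
  1 + ∣ p - a ∣     ≤⟨ x∈p⇒∣p-x∣<∣p∣ a∈p ⟩
  ∣ p ∣             ∎
  where
  open ≤-Reasoning
  b∈p-a : b ∈ p - a
  b∈p-a = x∈p∧x≢y⇒x∈p-y b∈p b≢a
  c∈p-a-b : c ∈ p - a - b
  c∈p-a-b = x∈p∧x≢y⇒x∈p-y (x∈p∧x≢y⇒x∈p-y c∈p c≢a) c≢b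

x∈p─q⇒x∉q : ∀ {n} (p q : Subset n) {x} → x ∈ p ─ q → x ∉ q
x∈p─q⇒x∉q (_ ∷ p) (outside ∷ q) here      ()
x∈p─q⇒x∉q (_ ∷ p) (_ ∷ q)       (there m) (there k) = x∈p─q⇒x∉q p q m k

x∈p-y⇒x≢y : ∀ {n} {p : Subset n} {x y} → x ∈ p - y → x ≢ y
x∈p-y⇒x≢y {p = p} {y = y} m = x∉⁅y⁆⇒x≢y (x∈p─q⇒x∉q p ⁅ y ⁆ m)

minCDS-below : ∀ {n} {E : Rel n} {S D : Subset n} {k} →
  IsMinCDS E S D → GammaCLess E S k → ∣ D ∣ < k
minCDS-below (_ , minimal) (D′ , cds′ , ∣D′∣<k) = ≤-trans (s≤s (minimal D′ cds′)) ∣D′∣<k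

cds-extend : ∀ {n} {E : Rel n} {w x} {D : Subset n} →
  IsCDS E (⊤ - w) D → x ∈ D → E w x → IsCDS E ⊤ D
cds-extend {w = w} {x} (_ , dominates , connected) x∈D w~x =
  ⊆⊤ , dominatesAll , connected
  where
  dominatesAll : DominatesOn _ ⊤ _
  dominatesAll y _ with y ≟ w
  ... | yes refl = inj₂ (x , x∈D , w~x)
  ... | no  y≢w  = dominates y (x∈p∧x≢y⇒x∈p-y ∈⊤ y≢w)

smallCDS-avoidsNeighbours : ∀ {n} {E : Rel n} {w} {D : Subset n} {k} →
  GammaC E ⊤ k → IsCDS E (⊤ - w) D → ∣ D ∣ < k → ∀ {x} → x ∈ D → ¬ E w x
smallCDS-avoidsNeighbours (_ , lower) cds ∣D∣<k x∈D w~x =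
  <⇒≱ ∣D∣<k (lower _ (cds-extend cds x∈D w~x))

clique-avoids : ∀ {n} (G : Graph n) {W D : Subset n} {w} →
  Clique G W → w ∈ W → D ⊆ ⊤ - w → (∀ {x} → x ∈ D → ¬ Adj G w x) →
  Empty (D ∩ W)
clique-avoids G {W} {D} {w} clique w∈W D⊆ nonAdjacent (x , x∈D∩W)
  with x∈p∩q⁻ D W x∈D∩W
... | x∈D , x∈W =
  nonAdjacent x∈D (clique w x w∈W x∈W (λ w≡x → x∈p-y⇒x≢y (D⊆ x∈D) (≡-sym w≡x)))

-- A vertex set inducing a connected subgraph on at most two vertices meets an
-- independent set at most once: a walk between two distinct independent
-- vertices must leave the first one through a third vertex.
smallConnected-meetsIndependent : ∀ {n} (G : Graph n) {I D : Subset n} →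
  Independent G I → ConnectedOn (Adj G) D → ∣ D ∣ ≤ 2 → ∣ D ∩ I ∣ ≤ 1
smallConnected-meetsIndependent G {I} {D} independent connected ∣D∣≤2 =
  atMostOneMember⇒∣p∣≤1 (D ∩ I) λ a∈D∩I b∈D∩I →
    unique (x∈p∩q⁻ D I a∈D∩I) (x∈p∩q⁻ D I b∈D∩I)
  where
  thirdVertex : ∀ {a b} → a ∈ D → b ∈ D → a ∈ I → b ∈ I → b ≢ a →
    Reach (Adj G) D a b → 3 ≤ ∣ D ∣
  thirdVertex a∈D b∈D a∈I b∈I b≢a here = ⊥-elim (b≢a refl)
  thirdVertex a∈D b∈D a∈I b∈I b≢a (step a~y y∈D _) =
    threeMembers⇒3≤∣p∣ a∈D b∈D y∈D b≢a
      (λ { refl → irrefl G a~y })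
      (λ { refl → independent _ _ a∈I b∈I a~y })

  unique : ∀ {a b} → a ∈ D × a ∈ I → b ∈ D × b ∈ I → a ≡ b
  unique {a} {b} (a∈D , a∈I) (b∈D , b∈I) with b ≟ a
  ... | yes b≡a = ≡-sym b≡a
  ... | no  b≢a =
    ⊥-elim (<⇒≱ (s≤s ∣D∣≤2) (thirdVertex a∈D b∈D a∈I b∈I b≢a (connected _ _ a∈D b∈D)))

lemma3p4 : ∀ {n} (G : Graph n) (I W : Subset n) →
    Connected G → MaximalVertexCritical 3 G →
    MaximumIndependent G I → MaximumClique G W →
    ∀ w → w ∈ W → (D : Subset n) → IsMinCDS (Adj G) (⊤ - w) D →
    ∣ D ∩ W ∣ ≡ 0 × ∣ D ∩ I ∣ ≤ 1
lemma3p4 G I W _ (_ , (_ , γc≡3 , critical)) (independent , _) (clique , _)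
         w w∈W D minCDS@(cds@(D⊆ , _ , connected) , _) =
  empty⇒∣p∣≡0 (clique-avoids G clique w∈W D⊆ nonAdjacent) ,
  smallConnected-meetsIndependent G independent connected (≤-pred ∣D∣<3)
  where
  ∣D∣<3 : ∣ D ∣ < 3
  ∣D∣<3 = minCDS-below minCDS (critical w)

  nonAdjacent : ∀ {x} → x ∈ D → ¬ Adj G w x
  nonAdjacent = smallCDS-avoidsNeighbours γc≡3 cds ∣D∣<3
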